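{- Let $G$ be a graph with a pendant vertex $v$. Then $p(G)=p(G-v)$.
   Context: Graphs are finite and simple; a pendant vertex is a vertex of degree one. For an acyclic digraph $D$, $P(D)$ is the graph on $V(D)$ with $uv$ an edge iff $(u,v)\in A(D)$ or $(v,u)\in A(D)$ or $u,v$ have a common out-neighbor in $D$. A phylogeny digraph for $G$ is an acyclic digraph $D$ with $G$ an induced subgraph of $P(D)$ and no arcs from $V(D)\setminus V(G)$ to $V(G)$; the phylogeny number $p(G)$ is the minimum of $|V(D)\setminus V(G)|$ over such $D$. -}

module Defs where

open import Data.Nat using (ℕ; suc; _+_; _≤_)
open import Data.Bool using (Bool; true; false; if_then_else_)
open import Data.Fin using (Fin; _↑ˡ_; _↑ʳ_; punchIn)
open import Data.List using (List; map)
open import Data.Nat.ListAction using (sum)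
open import Data.List.Base using (allFin)
open import Data.Product using (Σ; ∃; _×_)
open import Data.Sum using (_⊎_)
open import Relation.Binary.PropositionalEquality using (_≡_; _≢_)
open import Relation.Binary.Construct.Closure.ReflexiveTransitive using (Star)
open import Relation.Nullary using (¬_)
open import Function.Bundles using (_⇔_)

record Graph (n : ℕ) : Set where
  field
    adj    : Fin n → Fin n → Bool
    sym    : ∀ u v → adj u v ≡ adj v u
    irrefl : ∀ v → adj v v ≡ false
open Graph public

Adj : ∀ {n} → Graph n → Fin n → Fin n → Set
Adj G u v = adj G u v ≡ true

degree : ∀ {n} → Graph n → Fin n → ℕ
degree {n} G v = sum (map (λ w → if adj G v w then 1 else 0) (allFin n))

Pendant : ∀ {n} → Graph n → Fin n → Set
Pendant G v = degree G v ≡ 1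

deleteVertex : ∀ {n} → Graph (suc n) → Fin (suc n) → Graph n
deleteVertex G v = record
  { adj    = λ x y → adj G (punchIn v x) (punchIn v y)
  ; sym    = λ x y → sym G (punchIn v x) (punchIn v y)
  ; irrefl = λ x → irrefl G (punchIn v x)
  }

Digraph : ℕ → Set
Digraph m = Fin m → Fin m → Bool

Arc : ∀ {m} → Digraph m → Fin m → Fin m → Set
Arc D u v = D u v ≡ true

Acyclic : ∀ {m} → Digraph m → Set
Acyclic D = ∀ u v → Arc D u v → ¬ Star (Arc D) v u

PAdj : ∀ {m} → Digraph m → Fin m → Fin m → Set
PAdj D x y = x ≢ y × (Arc D x y ⊎ Arc D y x ⊎ ∃ λ w → Arc D x w × Arc D y w)

-- A phylogeny digraph for G with k additional vertices.
-- V(D) = Fin (n + k); V(G) is embedded as the first n vertices (u ↑ˡ k),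
-- the new vertices are n ↑ʳ x.
record PhylogenyDigraph {n : ℕ} (G : Graph n) (k : ℕ) : Set where
  field
    arcs    : Digraph (n + k)
    acyclic : Acyclic arcs
    induced : ∀ u v → Adj G u v ⇔ PAdj arcs (u ↑ˡ k) (v ↑ˡ k)
    noBack  : ∀ (x : Fin k) (u : Fin n) → ¬ Arc arcs (n ↑ʳ x) (u ↑ˡ k)

IsPhylogenyNumber : ∀ {n} → Graph n → ℕ → Set
IsPhylogenyNumber G k = PhylogenyDigraph G k × (∀ k′ → PhylogenyDigraph G k′ → k ≤ k′)

module Submission where

-- Write p = v ↑ˡ k for the copy of v in a phylogeny digraph.
-- * Deleting p from a phylogeny digraph for G gives one for G - v: acyclicity
--   and "no arcs back into G" survive, and an edge of P between vertices of
--   G - v could only be lost if p were a common out-neighbour of two of them,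
--   but every in-neighbour of p from G is a neighbour of v, and v has one.
-- * Adding p to a phylogeny digraph for G - v as a sink whose only in-neighbour
--   is u gives one for G: a sink closes no cycle, p becomes P-adjacent exactly
--   to u, and p is a common out-neighbour of no pair.
-- Hence G and G - v admit phylogeny digraphs with the same numbers of extra
-- vertices and so have the same minimum.

open import Defs hiding (sym)
open import Data.Nat using (ℕ; suc; _+_; pred)
open import Data.Fin using (Fin; zero; suc; _↑ˡ_; _↑ʳ_; punchIn; punchOut)
open import Data.Fin.Properties
  using (_≟_; punchIn-injective; punchInᵢ≢i; punchOut-cong; punchOut-punchIn; punchIn-punchOut; ↑ˡ-injective; suc-injective)
open import Data.Bool using (Bool; true; false; if_then_else_)
open import Data.List.Base using (tabulate)
open import Data.List.Properties using (map-tabulate)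
open import Data.Nat.ListAction using (sum)
open import Data.Product using (Σ; ∃; _×_; _,_; proj₁; proj₂)
open import Data.Sum using (_⊎_; inj₁; inj₂)
open import Data.Empty using (⊥; ⊥-elim)
open import Relation.Binary.PropositionalEquality
  using (_≡_; _≢_; refl; sym; trans; cong; cong₂; subst; subst₂)
open import Relation.Binary.Construct.Closure.ReflexiveTransitive using (Star; ε; _◅_; gmap)
open import Relation.Nullary using (¬_; yes; no)
open import Relation.Nullary.Decidable using (isYes)
open import Function using (_∘_; id)
open import Function.Bundles using (_⇔_; mk⇔; Equivalence)
open import Function.Construct.Composition using (_⇔-∘_)
open import Function.Construct.Symmetry using (⇔-sym)

count : ∀ {m} → (Fin m → Bool) → ℕ
count f = sum (tabulate (λ i → if f i then 1 else 0))

degree≡count : ∀ {n} (G : Graph n) v → degree G v ≡ count (adj G v)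
degree≡count G v = cong sum (map-tabulate id (λ w → if adj G v w then 1 else 0))

count≡0 : ∀ {m} (f : Fin m → Bool) → count f ≡ 0 → ∀ i → f i ≢ true
count≡0 {suc m} f c i fi with f zero in f0
count≡0 {suc m} f () i fi | true
count≡0 {suc m} f c zero fi | false with trans (sym f0) fi
... | ()
count≡0 {suc m} f c (suc i) fi | false = count≡0 (f ∘ suc) c i fi

count≡1 : ∀ {m} (f : Fin m → Bool) → count f ≡ 1 →
  Σ (Fin m) λ i → f i ≡ true × (∀ j → f j ≡ true → j ≡ i)
count≡1 {suc m} f c with f zero in f0
... | true = zero , f0 , onlyZero
  where
  onlyZero : ∀ j → f j ≡ true → j ≡ zero
  onlyZero zero    _  = refl
  onlyZero (suc j) fj = ⊥-elim (count≡0 (f ∘ suc) (cong pred c) j fj)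
... | false with count≡1 (f ∘ suc) c
...   | i , fi , unique = suc i , fi , onlySuc
  where
  onlySuc : ∀ j → f j ≡ true → j ≡ suc i
  onlySuc zero fj with trans (sym f0) fj
  ... | ()
  onlySuc (suc j) fj = cong suc (unique j fj)

pendantNeighbour : ∀ {n} (G : Graph n) v → Pendant G v →
  Σ (Fin n) λ u → Adj G v u × (∀ w → Adj G v w → w ≡ u)
pendantNeighbour G v pe = count≡1 (adj G v) (trans (sym (degree≡count G v)) pe)

Adj-sym : ∀ {n} (G : Graph n) {a b} → Adj G a b → Adj G b a
Adj-sym G {a} {b} e = trans (Graph.sym G b a) e

Adj-irrefl : ∀ {n} (G : Graph n) {a} → ¬ Adj G a a
Adj-irrefl G {a} e with trans (sym (irrefl G a)) e
... | ()

Adj-swap : ∀ {n} (G : Graph n) {a b} → Adj G a b ⇔ Adj G b a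
Adj-swap G = mk⇔ (Adj-sym G) (Adj-sym G)

aroundPoint : ∀ {m} (p a : Fin (suc m)) → p ≡ a ⊎ ∃ λ x → punchIn p x ≡ a
aroundPoint p a with p ≟ a
... | yes p≡a = inj₁ p≡a
... | no p≢a  = inj₂ (punchOut p≢a , punchIn-punchOut p≢a)

punchIn-↑ˡ : ∀ {n} k (v : Fin (suc n)) (x : Fin n) → punchIn (v ↑ˡ k) (x ↑ˡ k) ≡ punchIn v x ↑ˡ k
punchIn-↑ˡ k zero    x       = refl
punchIn-↑ˡ k (suc v) zero    = refl
punchIn-↑ˡ k (suc v) (suc x) = cong suc (punchIn-↑ˡ k v x)

punchIn-↑ʳ : ∀ {n} k (v : Fin (suc n)) (y : Fin k) → punchIn (v ↑ˡ k) (n ↑ʳ y) ≡ suc n ↑ʳ y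
punchIn-↑ʳ k zero    y = refl
punchIn-↑ʳ {suc n} k (suc v) y = cong suc (punchIn-↑ʳ k v y)

↑ʳ≢↑ˡ : ∀ {n} k (y : Fin k) (u : Fin n) → n ↑ʳ y ≢ u ↑ˡ k
↑ʳ≢↑ˡ k y zero    ()
↑ʳ≢↑ˡ k y (suc u) e = ↑ʳ≢↑ˡ k y u (suc-injective e)

Restricts : ∀ {m} → Digraph (suc m) → Fin (suc m) → Digraph m → Set
Restricts E p E' = ∀ x y → E (punchIn p x) (punchIn p y) ≡ E' x y

restrict : ∀ {m} → Digraph (suc m) → Fin (suc m) → Digraph m
restrict E p x y = E (punchIn p x) (punchIn p y)

Sink : ∀ {m} → Digraph m → Fin m → Set
Sink E p = ∀ b → ¬ Arc E p b

restrict-acyclic : ∀ {m} {E : Digraph (suc m)} {p} → Acyclic E → Acyclic (restrict E p)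
restrict-acyclic {p = p} acyc a b ab walk = acyc (punchIn p a) (punchIn p b) ab (gmap (punchIn p) id walk)

sinkWalk : ∀ {m} {E : Digraph m} {p c} → Sink E p → Star (Arc E) p c → p ≡ c
sinkWalk sink ε          = refl
sinkWalk sink (arc ◅ _) = ⊥-elim (sink _ arc)

-- A walk between two vertices other than a sink p avoids p, so it is a walk
-- of the digraph with p deleted.
liftWalk : ∀ {m} {E : Digraph (suc m)} {E' p} → Restricts E p E' → Sink E p →
  ∀ {a c} → Star (Arc E) a c → ∀ x z → punchIn p x ≡ a → punchIn p z ≡ c → Star (Arc E') x z
liftWalk {p = p} r sink ε x z refl x≡z =
  subst (Star _ x) (punchIn-injective p x z (sym x≡z)) ε
liftWalk {p = p} r sink (_◅_ {j = b} arc walk) x z refl c≡z with aroundPoint p b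
... | inj₁ refl = ⊥-elim (punchInᵢ≢i p z (trans c≡z (sym (sinkWalk sink walk))))
... | inj₂ (y , refl) = trans (sym (r x y)) arc ◅ liftWalk r sink walk y z refl c≡z

sink-acyclic : ∀ {m} {E : Digraph (suc m)} {E' p} → Restricts E p E' → Sink E p →
  Acyclic E' → Acyclic E
sink-acyclic {p = p} r sink acyc' a b ab walk with aroundPoint p a | aroundPoint p b
... | inj₁ refl | _ = sink b ab
... | inj₂ (x , refl) | inj₁ refl = punchInᵢ≢i p x (sym (sinkWalk sink walk))
... | inj₂ (x , refl) | inj₂ (y , refl) =
  acyc' x y (trans (sym (r x y)) ab) (liftWalk r sink walk y x refl refl)

PAdj-sym : ∀ {m} {E : Digraph m} {x y} → PAdj E x y → PAdj E y x
PAdj-sym (x≢y , inj₁ arc)               = x≢y ∘ sym , inj₂ (inj₁ arc)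
PAdj-sym (x≢y , inj₂ (inj₁ arc))        = x≢y ∘ sym , inj₁ arc
PAdj-sym (x≢y , inj₂ (inj₂ (w , a , b))) = x≢y ∘ sym , inj₂ (inj₂ (w , b , a))

PAdj-swap : ∀ {m} {E : Digraph m} {x y} → PAdj E x y ⇔ PAdj E y x
PAdj-swap = mk⇔ PAdj-sym PAdj-sym

PAdj-restrict : ∀ {m} {E : Digraph (suc m)} {E' p} → Restricts E p E' → ∀ x y →
  (x ≢ y → Arc E (punchIn p x) p → Arc E (punchIn p y) p → ⊥) →
  PAdj E' x y ⇔ PAdj E (punchIn p x) (punchIn p y)
PAdj-restrict {E = E} {E'} {p} r x y unshared = mk⇔ to from
  where
  to : PAdj E' x y → PAdj E (punchIn p x) (punchIn p y)
  to (x≢y , inj₁ arc) = x≢y ∘ punchIn-injective p x y , inj₁ (trans (r x y) arc)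
  to (x≢y , inj₂ (inj₁ arc)) = x≢y ∘ punchIn-injective p x y , inj₂ (inj₁ (trans (r y x) arc))
  to (x≢y , inj₂ (inj₂ (w , a , b))) =
    x≢y ∘ punchIn-injective p x y , inj₂ (inj₂ (punchIn p w , trans (r x w) a , trans (r y w) b))
  from : PAdj E (punchIn p x) (punchIn p y) → PAdj E' x y
  from (x≢y , inj₁ arc) = x≢y ∘ cong (punchIn p) , inj₁ (trans (sym (r x y)) arc)
  from (x≢y , inj₂ (inj₁ arc)) = x≢y ∘ cong (punchIn p) , inj₂ (inj₁ (trans (sym (r y x)) arc))
  from (x≢y , inj₂ (inj₂ (w , a , b))) with aroundPoint p w
  ... | inj₁ refl = ⊥-elim (unshared (x≢y ∘ cong (punchIn p)) a b)
  ... | inj₂ (w' , refl) =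
    x≢y ∘ cong (punchIn p) , inj₂ (inj₂ (w' , trans (sym (r x w')) a , trans (sym (r y w')) b))

sink-PAdj : ∀ {m} {E : Digraph m} {p c} → Sink E p → PAdj E p c → Arc E c p
sink-PAdj sink (_ , inj₁ arc)               = ⊥-elim (sink _ arc)
sink-PAdj sink (_ , inj₂ (inj₁ arc))        = arc
sink-PAdj sink (_ , inj₂ (inj₂ (w , a , _))) = ⊥-elim (sink w a)

-- E' extended by a new vertex p (the others renumbered by punchIn p) which
-- is a sink whose only in-neighbour is t.
addSink : ∀ {m} → Digraph m → Fin (suc m) → Fin m → Digraph (suc m)
addSink E' p t a b with p ≟ a | p ≟ b
... | yes _   | _      = false
... | no p≢a | yes _  = isYes (punchOut p≢a ≟ t)
... | no p≢a | no p≢b = E' (punchOut p≢a) (punchOut p≢b)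

punchOut-punchIn′ : ∀ {m} (p : Fin (suc m)) x (p≢x : p ≢ punchIn p x) → punchOut p≢x ≡ x
punchOut-punchIn′ p x p≢x = trans (punchOut-cong p refl) (punchOut-punchIn p)

addSink-restricts : ∀ {m} (E' : Digraph m) p t → Restricts (addSink E' p t) p E'
addSink-restricts E' p t x y with p ≟ punchIn p x | p ≟ punchIn p y
... | yes p≡x | _        = ⊥-elim (punchInᵢ≢i p x (sym p≡x))
... | no _    | yes p≡y = ⊥-elim (punchInᵢ≢i p y (sym p≡y))
... | no p≢x | no p≢y  = cong₂ E' (punchOut-punchIn′ p x p≢x) (punchOut-punchIn′ p y p≢y)

addSink-sink : ∀ {m} (E' : Digraph m) p t → Sink (addSink E' p t) p
addSink-sink E' p t b arc with p ≟ p
addSink-sink E' p t b () | yes _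
... | no p≢p = p≢p refl

addSink-in : ∀ {m} (E' : Digraph m) p t x → Arc (addSink E' p t) (punchIn p x) p → x ≡ t
addSink-in E' p t x arc with p ≟ punchIn p x | p ≟ p
... | yes p≡x | _       = ⊥-elim (punchInᵢ≢i p x (sym p≡x))
... | no _    | no p≢p = ⊥-elim (p≢p refl)
... | no p≢x | yes _ with punchOut p≢x ≟ t
...   | yes x≡t = trans (sym (punchOut-punchIn′ p x p≢x)) x≡t
addSink-in E' p t x () | no p≢x | yes _ | no _

addSink-arc : ∀ {m} (E' : Digraph m) p t → Arc (addSink E' p t) (punchIn p t) p
addSink-arc E' p t with p ≟ punchIn p t | p ≟ p
... | yes p≡t | _       = ⊥-elim (punchInᵢ≢i p t (sym p≡t))
... | no _    | no p≢p = ⊥-elim (p≢p refl)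
... | no p≢t | yes _ with punchOut p≢t ≟ t
...   | yes _   = refl
...   | no t≢t = ⊥-elim (t≢t (punchOut-punchIn′ p t p≢t))

PAdj-deleteVertex : ∀ {n k} (v : Fin (suc n)) {E : Digraph (suc n + k)} {E'} →
  Restricts E (v ↑ˡ k) E' →
  (∀ x y → x ≢ y → Arc E (punchIn v x ↑ˡ k) (v ↑ˡ k) → Arc E (punchIn v y ↑ˡ k) (v ↑ˡ k) → ⊥) →
  ∀ x y → PAdj E' (x ↑ˡ k) (y ↑ˡ k) ⇔ PAdj E (punchIn v x ↑ˡ k) (punchIn v y ↑ˡ k)
PAdj-deleteVertex {k = k} v {E} {E'} r unshared x y =
  subst₂ (λ a b → PAdj E' (x ↑ˡ k) (y ↑ˡ k) ⇔ PAdj E a b) (punchIn-↑ˡ k v x) (punchIn-↑ˡ k v y)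
    (PAdj-restrict {E = E} {p = v ↑ˡ k} r (x ↑ˡ k) (y ↑ˡ k) unshared′)
  where
  relabel : ∀ z → Arc E (punchIn (v ↑ˡ k) (z ↑ˡ k)) (v ↑ˡ k) → Arc E (punchIn v z ↑ˡ k) (v ↑ˡ k)
  relabel z = subst (λ c → Arc E c (v ↑ˡ k)) (punchIn-↑ˡ k v z)
  unshared′ : x ↑ˡ k ≢ y ↑ˡ k →
    Arc E (punchIn (v ↑ˡ k) (x ↑ˡ k)) (v ↑ˡ k) → Arc E (punchIn (v ↑ˡ k) (y ↑ˡ k)) (v ↑ˡ k) → ⊥
  unshared′ x≢y a b = unshared x y (x≢y ∘ cong (_↑ˡ k)) (relabel x a) (relabel y b)

arc-deleteVertex : ∀ {n k} (v : Fin (suc n)) {E : Digraph (suc n + k)} {E'} →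
  Restricts E (v ↑ˡ k) E' →
  ∀ (y : Fin k) (u : Fin n) → E' (n ↑ʳ y) (u ↑ˡ k) ≡ E (suc n ↑ʳ y) (punchIn v u ↑ˡ k)
arc-deleteVertex {k = k} v {E} r y u =
  trans (sym (r (_ ↑ʳ y) (u ↑ˡ k))) (cong₂ E (punchIn-↑ʳ k v y) (punchIn-↑ˡ k v u))

deletePendant : ∀ {n k} (G : Graph (suc n)) v → Pendant G v →
  PhylogenyDigraph G k → PhylogenyDigraph (deleteVertex G v) k
deletePendant {k = k} G v pe D = record
  { arcs    = restrict arcs (v ↑ˡ k)
  ; acyclic = restrict-acyclic acyclic
  ; induced = λ x y →
      ⇔-sym (PAdj-deleteVertex {k = k} v {E = arcs} r unshared x y) ⇔-∘ induced (punchIn v x) (punchIn v y)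
  ; noBack  = λ y u arc → noBack y (punchIn v u) (trans (sym (arc-deleteVertex {k = k} v {E = arcs} r y u)) arc)
  }
  where
  open PhylogenyDigraph D
  r : Restricts arcs (v ↑ˡ k) (restrict arcs (v ↑ˡ k))
  r _ _ = refl
  -- an in-neighbour of v ↑ˡ k from G is P-adjacent to it, hence a neighbour of v
  arcToNeighbour : ∀ x → Arc arcs (punchIn v x ↑ˡ k) (v ↑ˡ k) → Adj G v (punchIn v x)
  arcToNeighbour x arc =
    Adj-sym G (Equivalence.from (induced (punchIn v x) v) (punchInᵢ≢i v x ∘ ↑ˡ-injective k _ _ , inj₁ arc))
  unshared : ∀ x y → x ≢ y → Arc arcs (punchIn v x ↑ˡ k) (v ↑ˡ k) → Arc arcs (punchIn v y ↑ˡ k) (v ↑ˡ k) → ⊥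
  unshared x y x≢y a b with pendantNeighbour G v pe
  ... | _ , _ , unique =
    x≢y (punchIn-injective v x y (trans (unique _ (arcToNeighbour x a)) (sym (unique _ (arcToNeighbour y b)))))

-- A phylogeny digraph for G - v extends to one for G with the same number of
-- extra vertices: add v ↑ˡ k as a sink whose only in-neighbour is u ↑ˡ k.
module AddPendant {n k} (G : Graph (suc n)) (v : Fin (suc n)) (pe : Pendant G v)
                  (D' : PhylogenyDigraph (deleteVertex G v) k) where
  open PhylogenyDigraph D' renaming (arcs to E'; acyclic to acyclic'; induced to induced'; noBack to noBack')

  u : Fin (suc n)
  u = proj₁ (pendantNeighbour G v pe)

  v-u : Adj G v u
  v-u = proj₁ (proj₂ (pendantNeighbour G v pe))

  onlyNeighbour : ∀ w → Adj G v w → w ≡ u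
  onlyNeighbour = proj₂ (proj₂ (pendantNeighbour G v pe))

  v≢u : v ≢ u
  v≢u v≡u = Adj-irrefl G (subst (Adj G v) (sym v≡u) v-u)

  u′ : Fin n
  u′ = punchOut v≢u

  p : Fin (suc (n + k))
  p = v ↑ˡ k

  E : Digraph (suc n + k)
  E = addSink E' p (u′ ↑ˡ k)

  r : Restricts E p E'
  r = addSink-restricts E' p (u′ ↑ˡ k)

  arcToV : ∀ x → Arc E (punchIn v x ↑ˡ k) p → x ≡ u′
  arcToV x arc = ↑ˡ-injective k _ _
    (addSink-in E' p (u′ ↑ˡ k) (x ↑ˡ k) (subst (λ c → Arc E c p) (sym (punchIn-↑ˡ k v x)) arc))

  arcFromU : Arc E (punchIn v u′ ↑ˡ k) p
  arcFromU = subst (λ c → Arc E c p) (punchIn-↑ˡ k v u′) (addSink-arc E' p (u′ ↑ˡ k))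

  pendantEdge : ∀ x → Adj G v (punchIn v x) ⇔ PAdj E p (punchIn v x ↑ˡ k)
  pendantEdge x = mk⇔ to from
    where
    x≡u′ : punchIn v x ≡ u → x ≡ u′
    x≡u′ e = punchIn-injective v x u′ (trans e (sym (punchIn-punchOut v≢u)))
    to : Adj G v (punchIn v x) → PAdj E p (punchIn v x ↑ˡ k)
    to e with x≡u′ (onlyNeighbour _ e)
    ... | refl = (λ p≡x → punchInᵢ≢i v u′ (sym (↑ˡ-injective k _ _ p≡x))) , inj₂ (inj₁ arcFromU)
    from : PAdj E p (punchIn v x ↑ˡ k) → Adj G v (punchIn v x)
    from adjacent with arcToV x (sink-PAdj {E = E} (addSink-sink E' p (u′ ↑ˡ k)) adjacent)
    ... | refl = subst (Adj G v) (sym (punchIn-punchOut v≢u)) v-u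

  -- P(E) induces G on the first suc n vertices: pairs containing v are
  -- handled by pendantEdge, the others are inherited from D' since p is a
  -- common out-neighbour of no pair.
  induced-G : ∀ a b → Adj G a b ⇔ PAdj E (a ↑ˡ k) (b ↑ˡ k)
  induced-G a b with aroundPoint v a | aroundPoint v b
  ... | inj₁ refl | inj₁ refl = mk⇔ (⊥-elim ∘ Adj-irrefl G) (λ adjacent → ⊥-elim (proj₁ adjacent refl))
  ... | inj₁ refl | inj₂ (y , refl) = pendantEdge y
  ... | inj₂ (x , refl) | inj₁ refl = PAdj-swap {E = E} ⇔-∘ (pendantEdge x ⇔-∘ Adj-swap G)
  ... | inj₂ (x , refl) | inj₂ (y , refl) = PAdj-deleteVertex {k = k} v {E = E} r unshared x y ⇔-∘ induced' x y
    where
    unshared : ∀ x y → x ≢ y → Arc E (punchIn v x ↑ˡ k) p → Arc E (punchIn v y ↑ˡ k) p → ⊥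
    unshared x y x≢y a b = x≢y (trans (arcToV x a) (sym (arcToV y b)))

  -- No arc enters G from an extra vertex: arcs into p come only from u ↑ˡ k,
  -- and arcs into the other vertices are those of D'.
  noBack-G : ∀ (y : Fin k) (w : Fin (suc n)) → ¬ Arc E (suc n ↑ʳ y) (w ↑ˡ k)
  noBack-G y w arc with aroundPoint v w
  ... | inj₁ refl = ↑ʳ≢↑ˡ k y u′ (addSink-in E' p (u′ ↑ˡ k) (n ↑ʳ y)
                      (subst (λ c → Arc E c p) (sym (punchIn-↑ʳ k v y)) arc))
  ... | inj₂ (w′ , refl) = noBack' y w′ (trans (arc-deleteVertex {k = k} v {E = E} r y w′) arc)

  addPendant : PhylogenyDigraph G k
  addPendant = record
    { arcs    = E
    ; acyclic = sink-acyclic r (addSink-sink E' p (u′ ↑ˡ k)) acyclic'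
    ; induced = induced-G
    ; noBack  = noBack-G
    }

open AddPendant using (addPendant)

corollary3 : ∀ {n} (G : Graph (suc n)) (v : Fin (suc n)) → Pendant G v →
    ∀ (k : ℕ) → IsPhylogenyNumber G k ⇔ IsPhylogenyNumber (deleteVertex G v) k
corollary3 G v pe k = mk⇔
  (λ (D , minimal) → deletePendant G v pe D , λ k′ D′ → minimal k′ (addPendant G v pe D′))
  (λ (D′ , minimal) → addPendant G v pe D′ , λ k′ D → minimal k′ (deletePendant G v pe D))
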